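{- Let $\varphi$ be an instance of \textsc{2-Clause 3-SAT} and let $G(\varphi)$ be the graph constructed from $\varphi$ as described in the context. If $\varphi$ is satisfiable, then $\mathrm{wcol}_2(G(\varphi))\le 5$.
   Context: \textsc{2-Clause 3-SAT}: a CNF formula $\varphi$ with clauses $c_1,\dots,c_m$ over variables $x_1,\dots,x_n$, where each clause contains at most 3 variables and each literal ($x_j$ or $\overline{x}_j$) appears in exactly 2 clauses; it is assumed that no variable appears twice in a clause and that every clause has 2 or 3 literals. Construction of $G(\varphi)$: for each clause $c_i$ create 6 vertices $u_i^1,\dots,u_i^6$; if $c_i$ contains only 2 literals, add 2 more vertices $f_i,f_i'$, each adjacent to all of $u_i^1,\dots,u_i^6$. For each variable $x_j$ create two adjacent vertices $v_j$ (for $x_j$) and $v_j'$ (for $\overline{x}_j$). Make $v_j$ adjacent to each of $u_i^1,\dots,u_i^6$ for every clause $c_i$ containing the literal $x_j$, and $v_j'$ adjacent to each of $u_i^1,\dots,u_i^6$ for every clause $c_i$ containing $\overline{x}_j$. Weak coloring number: for a total order $\sigma$ on $V(G)$ and $u\neq v$, $v$ is weakly $r$-reachable from $u$ if $v\not<_\sigma u$ and there is a $u$-$v$ path $P$ of length at most $r$ whose internal vertices $p$ all satisfy $p<_\sigma v$; $\mathrm{wreach}_r(u,G_\sigma)$ is the set of such $v$ and $\mathrm{wcol}_r(G)=\min_\sigma\max_u|\mathrm{wreach}_r(u,G_\sigma)|$ over total orders $\sigma$. -}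

module Defs where

open import Level using (0ℓ)
open import Data.Nat using (ℕ; _≤_; _+_)
open import Data.Fin using (Fin)
open import Data.Bool using (Bool; true; false)
open import Data.Product using (Σ; _×_; _,_; proj₁)
open import Data.Sum using (_⊎_)
open import Data.List using (List; []; _∷_; _++_; length; map)
open import Data.List.Membership.Propositional using (_∈_)
open import Data.List.Relation.Unary.All using (All)
open import Data.List.Relation.Unary.Unique.Propositional using (Unique)
open import Data.List.Relation.Unary.Linked using (Linked)
open import Relation.Binary.Core using (Rel)
open import Relation.Binary.Structures using (IsStrictTotalOrder)
open import Relation.Binary.PropositionalEquality using (_≡_; _≢_)
open import Relation.Nullary using (¬_)

record Graph : Set₁ where
  field
    V   : Set
    _~_ : V → V → Set

-- |{x | P x}| ≤ k : every list of pairwise distinct elements satisfying P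
-- has length at most k.
AtMost : {A : Set} → ℕ → (A → Set) → Set
AtMost {A} k P = (xs : List A) → Unique xs → All P xs → length xs ≤ k

module _ (G : Graph) (_<_ : Rel (Graph.V G) 0ℓ) where
  open Graph G

  WReach : ℕ → V → V → Set
  WReach r u v =
    u ≢ v × ¬ (v < u) ×
    Σ (List V) λ ps →
      Linked _~_ (u ∷ ps ++ v ∷ []) ×
      Unique (u ∷ ps ++ v ∷ []) ×
      (length ps + 1 ≤ r) ×
      All (λ p → p < v) ps

WcolAtMost : ℕ → Graph → ℕ → Set₁
WcolAtMost r G k =
  Σ (Rel (Graph.V G) 0ℓ) λ _<_ →
    IsStrictTotalOrder _≡_ _<_ ×
    ((u : Graph.V G) → AtMost k (WReach G _<_ r u))

-- literal (j , true) is x_j, literal (j , false) is ¬x_j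
Lit : ℕ → Set
Lit n = Fin n × Bool

Clauses : ℕ → ℕ → Set
Clauses n m = Fin m → List (Lit n)

InExactlyTwo : ∀ {n m} → Clauses n m → Lit n → Set
InExactlyTwo {n} {m} cl ℓ =
  Σ (Fin m) λ i → Σ (Fin m) λ j →
    i ≢ j × ℓ ∈ cl i × ℓ ∈ cl j ×
    ((k : Fin m) → ℓ ∈ cl k → k ≡ i ⊎ k ≡ j)

Is2Clause3SAT : ∀ {n m} → Clauses n m → Set
Is2Clause3SAT {n} {m} cl =
  ((i : Fin m) → length (cl i) ≡ 2 ⊎ length (cl i) ≡ 3) ×
  ((i : Fin m) → Unique (map proj₁ (cl i))) ×
  ((ℓ : Lit n) → InExactlyTwo cl ℓ)

_satisfies_ : ∀ {n} → (Fin n → Bool) → Lit n → Set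
α satisfies (j , b) = α j ≡ b

Satisfiable : ∀ {n m} → Clauses n m → Set
Satisfiable {n} {m} cl =
  Σ (Fin n → Bool) λ α →
    (i : Fin m) → Σ (Lit n) λ ℓ → ℓ ∈ cl i × α satisfies ℓ

data Vtx {n m : ℕ} (cl : Clauses n m) : Set where
  u  : Fin m → Fin 6 → Vtx cl
  f  : (i : Fin m) → length (cl i) ≡ 2 → Fin 2 → Vtx cl
  v  : Fin n → Bool → Vtx cl

data Edge {n m : ℕ} (cl : Clauses n m) : Vtx cl → Vtx cl → Set where
  fu : ∀ {i} (h : length (cl i) ≡ 2) (a : Fin 2) (l : Fin 6) →
       Edge cl (f i h a) (u i l)
  vv : (j : Fin n) → Edge cl (v j true) (v j false)
  vu : ∀ {j b i} (l : Fin 6) → (j , b) ∈ cl i → Edge cl (v j b) (u i l)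

G : ∀ {n m} → Clauses n m → Graph
G cl = record { V = Vtx cl ; _~_ = λ x y → Edge cl x y ⊎ Edge cl y x }

{-# OPTIONS --safe #-}
-- Order the vertices of G(φ) by rank: first the clause vertices u, then the f-vertices, then the
-- literal vertices made false by a satisfying assignment α, then those made true (ties broken
-- arbitrarily). A vertex u_i^l weakly 2-reaches the literal vertices of c_i, the f-vertices of c_i,
-- and, through a false literal of c_i only, its complement; as c_i has a true literal these are at
-- most |c_i| + (|c_i| - 1) + (2 if |c_i| = 2) = 5 vertices. An f-vertex reaches, through the clause
-- vertices below it, only the other f-vertex and the literals of its clause. A literal vertex
-- reaches its complement and, through the clause vertices, the at most 2 + 2 other literals of the
-- two clauses containing it. Each bound is obtained by listing a superset of size at most 5.
module Submission where

open import Defs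
open import Level using (0ℓ)
open import Data.Nat using (ℕ; suc; pred; _+_; _<_; _≤_; z≤n; s≤s; s≤s⁻¹; z<s; s<s)
open import Data.Nat.Properties
  using (<-isStrictTotalOrder; n≤1+n; module ≤-Reasoning; <⇒≤; ≤-reflexive; <⇒≱; ≤-refl; ≤-trans; +-mono-≤; m+n≤o⇒n≤o; ≡-irrelevant)
open import Data.Fin using (Fin; toℕ; zero; suc)
open import Data.Fin.Properties using (toℕ-injective)
open import Data.Bool using (Bool; true; false; not; if_then_else_)
import Data.Bool as Bool
open import Data.Product using (Σ; _×_; _,_; proj₁; proj₂)
open import Data.Product.Relation.Binary.Lex.Strict using (×-Lex; ×-isStrictTotalOrder)
open import Data.Product.Relation.Binary.Pointwise.NonDependent using (Pointwise)
open import Data.Sum using (_⊎_; inj₁; inj₂)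
open import Data.List using (List; []; _∷_; _++_; length; map)
open import Data.List.Properties using (length-++; length-map; length-removeAt; length-removeAt′)
open import Data.List.Membership.Propositional using (_∈_)
open import Data.List.Membership.Propositional.Properties using (∈-++⁺ˡ; ∈-++⁺ʳ; ∈-map⁺)
open import Data.List.Relation.Binary.Subset.Propositional using (_⊆_)
open import Data.List.Relation.Unary.Any using (here; there; _─_)
open import Data.List.Relation.Unary.All using ([]; _∷_)
import Data.List.Relation.Unary.All as All
open import Data.List.Relation.Unary.AllPairs using (_∷_)
open import Data.List.Relation.Unary.Unique.Propositional using (Unique)
open import Data.List.Relation.Unary.Linked using ([-]; _∷_)
open import Function.Base using (id; _on_)
open import Function.Definitions using (Injective)
open import Relation.Binary.Core using (Rel)
open import Relation.Binary.Structures using (IsStrictTotalOrder)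
open import Relation.Binary.Morphism.Structures using (IsOrderMonomorphism)
import Relation.Binary.Morphism.OrderMonomorphism as OrderMonomorphism
open import Relation.Binary.PropositionalEquality
  using (_≡_; _≢_; refl; sym; trans; cong; cong₂; subst; module ≡-Reasoning)
open import Relation.Nullary using (¬_; contradiction; does)

module _ {A : Set} where

  ∈-─⁺ : ∀ {x y} {xs : List A} (x∈xs : x ∈ xs) → y ∈ xs → y ≢ x → y ∈ (xs ─ x∈xs)
  ∈-─⁺ (here refl) (here y≡x) y≢x = contradiction y≡x y≢x
  ∈-─⁺ (here refl) (there y∈xs) _ = y∈xs
  ∈-─⁺ (there x∈xs) (here y≡z) _ = here y≡z
  ∈-─⁺ (there x∈xs) (there y∈xs) y≢x = there (∈-─⁺ x∈xs y∈xs y≢x)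

  length-─≤ : ∀ {x k} {xs : List A} (x∈xs : x ∈ xs) → length xs ≤ suc k → length (xs ─ x∈xs) ≤ k
  length-─≤ {xs = xs} x∈xs ≤k = s≤s⁻¹ (subst (_≤ _) (length-removeAt′ xs _) ≤k)

  Unique-⊆⇒length≤ : {xs ys : List A} → Unique xs → xs ⊆ ys → length xs ≤ length ys
  Unique-⊆⇒length≤ {[]} _ _ = z≤n
  Unique-⊆⇒length≤ {x ∷ xs} {ys} (x∉xs ∷ unique) xs⊆ys =
    subst (suc (length xs) ≤_) (sym (length-removeAt′ ys _))
      (s≤s (Unique-⊆⇒length≤ unique λ y∈xs →
        ∈-─⁺ (xs⊆ys (here refl)) (xs⊆ys (there y∈xs)) (λ { refl → All.lookup x∉xs y∈xs refl })))

  AtMost-⊆ : ∀ {k} {P : A → Set} (ys : List A) → (∀ {y} → P y → y ∈ ys) → length ys ≤ k → AtMost k P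
  AtMost-⊆ ys P⊆ys ≤k xs unique all = ≤-trans (Unique-⊆⇒length≤ unique (λ x∈xs → P⊆ys (All.lookup all x∈xs))) ≤k

pullback-isStrictTotalOrder :
  ∀ {a b ℓ₁ ℓ₂} {A : Set a} {B : Set b} {_≈_ : Rel B ℓ₁} {_<_ : Rel B ℓ₂} (key : A → B) →
  Injective _≡_ _≈_ key → IsStrictTotalOrder _≈_ _<_ → IsStrictTotalOrder _≡_ (_<_ on key)
pullback-isStrictTotalOrder key injective sto =
  OrderMonomorphism.isStrictTotalOrder isOrderMonomorphism sto
  where
  isOrderMonomorphism : IsOrderMonomorphism _ _ _ _ key
  isOrderMonomorphism = record
    { isOrderHomomorphism = record { cong = λ x≡y → IsStrictTotalOrder.Eq.reflexive sto (cong key x≡y) ; mono = id }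
    ; injective = injective
    ; cancel = id
    }

module _ (Γ : Graph) (_<_ : Rel (Graph.V Γ) 0ℓ) where
  open Graph Γ

  data Reach₂ (x y : V) : Set where
    edge : x ~ y → Reach₂ x y
    path : ∀ p → x ~ p → p ~ y → p < y → Reach₂ x y

  WReach₂⇒Reach₂ : ∀ {x y} → WReach Γ _<_ 2 x y → Reach₂ x y
  WReach₂⇒Reach₂ (_ , _ , [] , x~y ∷ [-] , _) = edge x~y
  WReach₂⇒Reach₂ (_ , _ , p ∷ [] , x~p ∷ p~y ∷ [-] , _ , _ , p<y ∷ []) = path p x~p p~y p<y
  WReach₂⇒Reach₂ (_ , _ , _ ∷ _ ∷ ps , _ , _ , s≤s (s≤s long) , _) = contradiction (m+n≤o⇒n≤o (length ps) long) λ ()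

module VertexOrder {n m : ℕ} (cl : Clauses n m) (α : Fin n → Bool) where

  rank : Vtx cl → ℕ
  rank (u _ _)   = 0
  rank (f _ _ _) = 1
  rank (v j b)   = 2 + (if does (α j Bool.≟ b) then 1 else 0)

  position : Vtx cl → ℕ × ℕ
  position (u i l)   = toℕ i , toℕ l
  position (f i _ a) = toℕ i , toℕ a
  position (v j b)   = toℕ j , (if b then 1 else 0)

  key : Vtx cl → ℕ × ℕ × ℕ
  key x = rank x , position x

  key-injective : Injective _≡_ (Pointwise _≡_ (Pointwise _≡_ _≡_)) key
  key-injective {u i l} {u i′ l′} (_ , i≡i′ , l≡l′) = cong₂ u (toℕ-injective i≡i′) (toℕ-injective l≡l′)
  key-injective {f _ h _} {f _ h′ _} (_ , i≡i′ , a≡a′) = f-cong (toℕ-injective i≡i′) h h′ (toℕ-injective a≡a′)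
    where
    f-cong : ∀ {i i′ a a′} → i ≡ i′ → ∀ h h′ → a ≡ a′ → f i h a ≡ f i′ h′ a′
    f-cong refl h h′ refl = cong (λ h → f _ h _) (≡-irrelevant h h′)
  key-injective {v j true} {v j′ true} (_ , j≡j′ , _) = cong (λ k → v k true) (toℕ-injective j≡j′)
  key-injective {v j false} {v j′ false} (_ , j≡j′ , _) = cong (λ k → v k false) (toℕ-injective j≡j′)
  key-injective {v _ true} {v _ false} (_ , _ , ())
  key-injective {v _ false} {v _ true} (_ , _ , ())
  key-injective {u _ _} {f _ _ _} (() , _)
  key-injective {u _ _} {v _ _} (() , _)
  key-injective {f _ _ _} {u _ _} (() , _)
  key-injective {f _ _ _} {v _ _} (() , _)
  key-injective {v _ _} {u _ _} (() , _)
  key-injective {v _ _} {f _ _ _} (() , _)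

  -- Opaque so that x and y can be inferred from a proof of x ≺ y.
  opaque
    _≺_ : Rel (Vtx cl) 0ℓ
    _≺_ = ×-Lex _≡_ _<_ (×-Lex _≡_ _<_ _<_) on key

    ≺-isStrictTotalOrder : IsStrictTotalOrder _≡_ _≺_
    ≺-isStrictTotalOrder = pullback-isStrictTotalOrder key key-injective
      (×-isStrictTotalOrder <-isStrictTotalOrder (×-isStrictTotalOrder <-isStrictTotalOrder <-isStrictTotalOrder))

    rank<⇒≺ : ∀ {x y} → rank x < rank y → x ≺ y
    rank<⇒≺ = inj₁

    rank>⇒⊀ : ∀ {x y} → rank y < rank x → ¬ (x ≺ y)
    rank>⇒⊀ y<x (inj₁ x<y) = <⇒≱ y<x (<⇒≤ x<y)
    rank>⇒⊀ y<x (inj₂ (x≡y , _)) = <⇒≱ y<x (≤-reflexive x≡y)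

  ≺-complement⇒false : ∀ {j b} → v j b ≺ v j (not b) → α j ≢ b
  ≺-complement⇒false {j} ≺not refl = rank>⇒⊀ (true-above-false j) ≺not
    where
    true-above-false : ∀ j → rank (v j (not (α j))) < rank (v j (α j))
    true-above-false j with α j
    ... | true  = ≤-refl
    ... | false = ≤-refl

ClauseSize : ∀ {n m} → Clauses n m → Fin m → Set
ClauseSize cl i = length (cl i) ≡ 2 ⊎ length (cl i) ≡ 3

module WReachCandidates {n m : ℕ} (cl : Clauses n m)
  (sizes : (i : Fin m) → ClauseSize cl i) (occurrences : (ℓ : Lit n) → InExactlyTwo cl ℓ)
  (α : Fin n → Bool) (sat : (i : Fin m) → Σ (Lit n) λ ℓ → ℓ ∈ cl i × α satisfies ℓ) where
  open VertexOrder cl α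

  litVertex : Lit n → Vtx cl
  litVertex (j , b) = v j b

  complementVertex : Lit n → Vtx cl
  complementVertex (j , b) = v j (not b)

  length-clause≤3 : ∀ i → length (cl i) ≤ 3
  length-clause≤3 i with sizes i
  ... | inj₁ h rewrite h = n≤1+n 2
  ... | inj₂ h rewrite h = ≤-refl

  fVertices : ∀ i → ClauseSize cl i → List (Vtx cl)
  fVertices i (inj₁ h) = f i h zero ∷ f i h (suc zero) ∷ []
  fVertices i (inj₂ _) = []

  f∈fVertices : ∀ {i h} a (s : ClauseSize cl i) → f i h a ∈ fVertices i s
  f∈fVertices {h = h} a (inj₁ h′) with refl ← ≡-irrelevant h h′ with a
  ... | zero     = here refl
  ... | suc zero = there (here refl)
  f∈fVertices {h = h} a (inj₂ h′) with () ← trans (sym h) h′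

  uCandidates : ∀ i {ℓ} → ℓ ∈ cl i → ClauseSize cl i → List (Vtx cl)
  uCandidates i ℓ∈ s = map litVertex (cl i) ++ map complementVertex (cl i ─ ℓ∈) ++ fVertices i s

  fCandidates : ∀ i → length (cl i) ≡ 2 → List (Vtx cl)
  fCandidates i h = map litVertex (cl i) ++ fVertices i (inj₁ h)

  vCandidates : ∀ j b → InExactlyTwo cl (j , b) → List (Vtx cl)
  vCandidates j b (i₁ , i₂ , _ , ∈₁ , ∈₂ , _) = v j (not b) ∷ map litVertex ((cl i₁ ─ ∈₁) ++ (cl i₂ ─ ∈₂))

  length-uCandidates≤5 : ∀ i {ℓ} (ℓ∈ : ℓ ∈ cl i) s → length (uCandidates i ℓ∈ s) ≤ 5
  length-uCandidates≤5 i ℓ∈ s = subst (_≤ 5) (sym length-uCandidates) (bound s)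
    where
    length-uCandidates : length (uCandidates i ℓ∈ s) ≡ length (cl i) + (pred (length (cl i)) + length (fVertices i s))
    length-uCandidates = begin
      length (map litVertex (cl i) ++ map complementVertex (cl i ─ ℓ∈) ++ fVertices i s)
        ≡⟨ length-++ (map litVertex (cl i)) ⟩
      length (map litVertex (cl i)) + length (map complementVertex (cl i ─ ℓ∈) ++ fVertices i s)
        ≡⟨ cong₂ _+_ (length-map litVertex (cl i)) (length-++ (map complementVertex (cl i ─ ℓ∈))) ⟩
      length (cl i) + (length (map complementVertex (cl i ─ ℓ∈)) + length (fVertices i s))
        ≡⟨ cong (λ k → length (cl i) + (k + length (fVertices i s)))
                (trans (length-map complementVertex (cl i ─ ℓ∈)) (length-removeAt (cl i) _)) ⟩
      length (cl i) + (pred (length (cl i)) + length (fVertices i s))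
        ∎
      where open ≡-Reasoning
    bound : ∀ s → length (cl i) + (pred (length (cl i)) + length (fVertices i s)) ≤ 5
    bound (inj₁ h) rewrite h = ≤-refl
    bound (inj₂ h) rewrite h = ≤-refl

  length-fCandidates≤5 : ∀ i h → length (fCandidates i h) ≤ 5
  length-fCandidates≤5 i h
    rewrite length-++ (map litVertex (cl i)) {fVertices i (inj₁ h)} | length-map litVertex (cl i) | h = n≤1+n 4

  length-vCandidates≤5 : ∀ j b t → length (vCandidates j b t) ≤ 5
  length-vCandidates≤5 j b (i₁ , i₂ , _ , ∈₁ , ∈₂ , _) = s≤s (begin
    length (map litVertex ((cl i₁ ─ ∈₁) ++ (cl i₂ ─ ∈₂))) ≡⟨ length-map litVertex ((cl i₁ ─ ∈₁) ++ _) ⟩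
    length ((cl i₁ ─ ∈₁) ++ (cl i₂ ─ ∈₂))                 ≡⟨ length-++ (cl i₁ ─ ∈₁) ⟩
    length (cl i₁ ─ ∈₁) + length (cl i₂ ─ ∈₂)             ≤⟨ +-mono-≤ (length-─≤ ∈₁ (length-clause≤3 i₁))
                                                                        (length-─≤ ∈₂ (length-clause≤3 i₂)) ⟩
    4                                                     ∎)
    where open ≤-Reasoning

  Reach : Vtx cl → Vtx cl → Set
  Reach = Reach₂ (G cl) _≺_

  complement∈uCandidates : ∀ {i j b ℓ} (ℓ∈ : ℓ ∈ cl i) → α satisfies ℓ → (s : ClauseSize cl i) →
                           (j , b) ∈ cl i → v j b ≺ v j (not b) → v j (not b) ∈ uCandidates i ℓ∈ s
  complement∈uCandidates {i} ℓ∈ ℓ-true s j,b∈ v≺v′ =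
    ∈-++⁺ʳ (map litVertex (cl i)) (∈-++⁺ˡ (∈-map⁺ complementVertex
      (∈-─⁺ ℓ∈ j,b∈ λ { refl → ≺-complement⇒false v≺v′ ℓ-true })))

  uCandidates-complete : ∀ {i l y ℓ} (ℓ∈ : ℓ ∈ cl i) → α satisfies ℓ → (s : ClauseSize cl i) →
                         Reach (u i l) y → y ∈ uCandidates i ℓ∈ s
  uCandidates-complete {i} _ _ s (edge (inj₂ (fu h a _))) =
    ∈-++⁺ʳ (map litVertex (cl i)) (∈-++⁺ʳ _ (f∈fVertices a s))
  uCandidates-complete _ _ _ (edge (inj₂ (vu _ j,b∈))) = ∈-++⁺ˡ (∈-map⁺ litVertex j,b∈)
  uCandidates-complete _ _ _ (path _ (inj₂ (fu _ _ _)) (inj₁ (fu _ _ _)) f≺u) = contradiction f≺u (rank>⇒⊀ z<s)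
  uCandidates-complete _ _ _ (path _ (inj₂ (vu _ _)) (inj₁ (vu _ _)) v≺u) = contradiction v≺u (rank>⇒⊀ z<s)
  uCandidates-complete ℓ∈ ℓ-true s (path _ (inj₂ (vu _ j,b∈)) (inj₁ (vv _)) v≺v′) = complement∈uCandidates ℓ∈ ℓ-true s j,b∈ v≺v′
  uCandidates-complete ℓ∈ ℓ-true s (path _ (inj₂ (vu _ j,b∈)) (inj₂ (vv _)) v≺v′) = complement∈uCandidates ℓ∈ ℓ-true s j,b∈ v≺v′

  fCandidates-complete : ∀ {i h a y} → ¬ (y ≺ f i h a) → Reach (f i h a) y → y ∈ fCandidates i h
  fCandidates-complete y⊀f (edge (inj₁ (fu _ _ _))) = contradiction (rank<⇒≺ z<s) y⊀f
  fCandidates-complete {i} {h} _ (path _ (inj₁ (fu _ _ _)) (inj₂ (fu _ a′ _)) _) =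
    ∈-++⁺ʳ (map litVertex (cl i)) (f∈fVertices a′ (inj₁ h))
  fCandidates-complete _ (path _ (inj₁ (fu _ _ _)) (inj₂ (vu _ j,b∈)) _) = ∈-++⁺ˡ (∈-map⁺ litVertex j,b∈)

  vCandidates-complete : ∀ {j b y} (t : InExactlyTwo cl (j , b)) → v j b ≢ y → ¬ (y ≺ v j b) →
                         Reach (v j b) y → y ∈ vCandidates j b t
  vCandidates-complete _ _ _ (edge (inj₁ (vv _))) = here refl
  vCandidates-complete _ _ _ (edge (inj₂ (vv _))) = here refl
  vCandidates-complete _ _ y⊀v (edge (inj₁ (vu _ _))) = contradiction (rank<⇒≺ z<s) y⊀v
  vCandidates-complete _ _ _ (path _ (inj₁ (vv _)) (inj₁ (vu _ _)) v≺u) = contradiction v≺u (rank>⇒⊀ z<s)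
  vCandidates-complete _ _ _ (path _ (inj₂ (vv _)) (inj₁ (vu _ _)) v≺u) = contradiction v≺u (rank>⇒⊀ z<s)
  vCandidates-complete _ v≢y _ (path _ (inj₁ (vv _)) (inj₂ (vv _)) _) = contradiction refl v≢y
  vCandidates-complete _ v≢y _ (path _ (inj₂ (vv _)) (inj₁ (vv _)) _) = contradiction refl v≢y
  vCandidates-complete _ _ y⊀v (path _ (inj₁ (vu _ _)) (inj₂ (fu _ _ _)) _) = contradiction (rank<⇒≺ (s<s z<s)) y⊀v
  vCandidates-complete (i₁ , i₂ , _ , ∈₁ , ∈₂ , only) v≢y _ (path _ (inj₁ (vu {i = i} _ j,b∈)) (inj₂ (vu _ ℓ∈)) _)
    with only i j,b∈
  ... | inj₁ refl = there (∈-map⁺ litVertex (∈-++⁺ˡ (∈-─⁺ ∈₁ ℓ∈ λ { refl → v≢y refl })))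
  ... | inj₂ refl = there (∈-map⁺ litVertex (∈-++⁺ʳ (cl i₁ ─ ∈₁) (∈-─⁺ ∈₂ ℓ∈ λ { refl → v≢y refl })))

  candidates : Vtx cl → List (Vtx cl)
  candidates (u i _)   = uCandidates i (proj₁ (proj₂ (sat i))) (sizes i)
  candidates (f i h _) = fCandidates i h
  candidates (v j b)   = vCandidates j b (occurrences (j , b))

  length-candidates≤5 : ∀ x → length (candidates x) ≤ 5
  length-candidates≤5 (u i _)   = length-uCandidates≤5 i (proj₁ (proj₂ (sat i))) (sizes i)
  length-candidates≤5 (f i h _) = length-fCandidates≤5 i h
  length-candidates≤5 (v j b)   = length-vCandidates≤5 j b (occurrences (j , b))

  WReach₂⊆candidates : ∀ {x y} → WReach (G cl) _≺_ 2 x y → y ∈ candidates x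
  WReach₂⊆candidates {u i _} wr with sat i
  ... | _ , ℓ∈ , ℓ-true = uCandidates-complete ℓ∈ ℓ-true (sizes i) (WReach₂⇒Reach₂ _ _ wr)
  WReach₂⊆candidates {f _ _ _} wr@(_ , y⊀x , _) = fCandidates-complete y⊀x (WReach₂⇒Reach₂ _ _ wr)
  WReach₂⊆candidates {v j b} wr@(x≢y , y⊀x , _) =
    vCandidates-complete (occurrences (j , b)) x≢y y⊀x (WReach₂⇒Reach₂ _ _ wr)

lemma1 : {n m : ℕ} (cl : Clauses n m) → Is2Clause3SAT cl → Satisfiable cl →
         WcolAtMost 2 (G cl) 5
lemma1 cl (sizes , _ , occurrences) (α , sat) =
  _≺_ , ≺-isStrictTotalOrder , λ x → AtMost-⊆ (candidates x) WReach₂⊆candidates (length-candidates≤5 x)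
  where
  open VertexOrder cl α
  open WReachCandidates cl sizes occurrences α sat
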